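{- Let $q$ be a prime power, let $T=\left\{\begin{pmatrix}1&x\\0&1\end{pmatrix} : x\in\mathbb F_{q^2}\right\}\le\mathrm{SL}(2,q^2)$, let $\Omega=\{g\in\mathrm{SL}(2,q^2) : (0,1)\,g\,(1,0)^{\mathsf T}\in\mathbb F_q\}$ and $\Omega^{\mathsf c}=\mathrm{SL}(2,q^2)\smallsetminus\Omega$. For $h\in\mathrm{GL}(2,q^2)$ let $\vartheta_h$ be the map on $2\times2$ matrices over $\mathbb F_{q^2}$ given by $x\mapsto h^{ -1}x\overline h$, where $\overline{\,\cdot\,}$ denotes the field automorphism $y\mapsto y^q$ of $\mathbb F_{q^2}$ applied entrywise. If $h\in N_{\mathrm{SL}(2,q^2)}(T)$, then $\vartheta_h(\Omega)=\Omega$ and $\vartheta_h(\Omega^{\mathsf c})=\Omega^{\mathsf c}$. -}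

module Defs where

open import Level using (Level; _⊔_) renaming (suc to lsuc)
open import Data.Nat as ℕ using (ℕ; zero; suc)
open import Data.Nat.Primality using (Prime)
open import Data.Fin using (Fin)
open import Data.Product using (Σ; ∃; _×_; _,_)
open import Relation.Nullary using (¬_)
open import Relation.Binary.PropositionalEquality using (_≡_)
open import Algebra.Bundles using (CommutativeRing)

IsPrimePower : ℕ → Set
IsPrimePower q = Σ ℕ λ p → Σ ℕ λ k → Prime p × (q ≡ p ℕ.^ suc k)

record Field (c ℓ : Level) : Set (lsuc (c ⊔ ℓ)) where
  field
    commutativeRing : CommutativeRing c ℓ
  open CommutativeRing commutativeRing public
  field
    0≉1     : ¬ (0# ≈ 1#)
    inverse : ∀ x → ¬ (x ≈ 0#) → ∃ λ y → (x * y) ≈ 1#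

module FieldDefs {c₀ ℓ₀ : Level} (K : Field c₀ ℓ₀) where
  open Field K

  HasCardinality : ℕ → Set (c₀ ⊔ ℓ₀)
  HasCardinality n =
    Σ (Fin n → Carrier) λ f →
      (∀ i j → f i ≈ f j → i ≡ j) × (∀ x → ∃ λ i → f i ≈ x)

  pow : Carrier → ℕ → Carrier
  pow x zero    = 1#
  pow x (suc n) = x * pow x n

  -- 2×2 matrices [[a , b] , [c , d]]
  record Mat : Set c₀ where
    constructor mat
    field a b c d : Carrier
  open Mat public

  _≈M_ : Mat → Mat → Set ℓ₀
  m ≈M n = (a m ≈ a n) × (b m ≈ b n) × (c m ≈ c n) × (d m ≈ d n)

  _·_ : Mat → Mat → Mat
  m · n = mat (a m * a n + b m * c n) (a m * b n + b m * d n)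
              (c m * a n + d m * c n) (c m * b n + d m * d n)

  det : Mat → Carrier
  det m = a m * d m - b m * c m

  -- adjugate; equals the inverse for matrices of determinant 1
  adj : Mat → Mat
  adj m = mat (d m) (- b m) (- c m) (a m)

  frobM : ℕ → Mat → Mat
  frobM q m = mat (pow (a m) q) (pow (b m) q) (pow (c m) q) (pow (d m) q)

  IsSL : Mat → Set ℓ₀
  IsSL m = det m ≈ 1#

  IsT : Mat → Set ℓ₀
  IsT t = (a t ≈ 1#) × (c t ≈ 0#) × (d t ≈ 1#)

  -- h ∈ N_{SL(2,K)}(T): h ∈ SL and h T h⁻¹ = T (both inclusions)
  InNormalizerT : Mat → Set (c₀ ⊔ ℓ₀)
  InNormalizerT h = IsSL h
    × (∀ t → IsT t → IsT ((h · t) · adj h))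
    × (∀ t → IsT t → IsT ((adj h · t) · h))

  InFq : ℕ → Carrier → Set ℓ₀
  InFq q y = pow y q ≈ y

  -- Ω = { g ∈ SL : (0,1) g (1,0)ᵀ = g₂₁ ∈ F_q }
  Ω : ℕ → Mat → Set ℓ₀
  Ω q g = IsSL g × InFq q (c g)

  Ωᶜ : ℕ → Mat → Set ℓ₀
  Ωᶜ q g = IsSL g × ¬ InFq q (c g)

  -- ϑ_h(x) = h⁻¹ x h̄   (h ∈ SL, so h⁻¹ = adj h)
  ϑ : ℕ → Mat → Mat → Mat
  ϑ q h x = (adj h · x) · frobM q h

  MapsOnto : (Mat → Mat) → (Mat → Set ℓ₀) → Set (c₀ ⊔ ℓ₀)
  MapsOnto f P = (∀ g → P g → P (f g))
    × (∀ g′ → P g′ → ∃ λ g → P g × (f g ≈M g′))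

-- An element h of the normaliser of T is upper triangular: the lower-left entry of h t h⁻¹
-- for t = [[1,1],[0,1]] is -c(h)², and a field has no nonzero nilpotents. For upper triangular h
-- the lower-left entry of ϑ_h(g) is N · c(g), where N = a(h)^(q+1) is the norm of a(h); it is a
-- nonzero element of F_q since x^(q²) = x in K. Multiplication by N preserves F_q and its
-- complement, and ϑ_h permutes SL(2, q²) (its inverse is g ↦ h g h̄⁻¹), so ϑ_h maps Ω and Ωᶜ
-- onto themselves.
module Submission where

open import Level using (Level; 0ℓ)
open import Data.Nat as ℕ using (ℕ; zero; suc; _∸_)
import Data.Nat.Properties as ℕₚ
open import Data.Product using (_×_; _,_; ∃; proj₁; proj₂)
open import Data.Fin as F using (Fin)
open import Data.Fin.Properties using (punchIn-punchOut; punchInᵢ≢i; punchIn-injective)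
open import Data.Fin.Permutation using (Permutation′; permutation)
open import Defs
open import Data.Maybe using (just; nothing)
open import Data.Vec.N-ary using (N-ary)
open import Relation.Nullary using (Dec; yes; no)
open import Data.Empty using (⊥-elim)
open import Relation.Binary.PropositionalEquality as ≡ using (_≡_; _≢_)
open import Relation.Binary.Definitions using (WeaklyDecidable; Decidable)
open import Algebra.Bundles using (CommutativeRing; RawRing)
open import Algebra.Solver.Ring.AlmostCommutativeRing
  using (_-Raw-AlmostCommutative⟶_; Induced-equivalence; fromCommutativeRing)

-- Tactic.RingSolver would need a zero test on the carrier; integer coefficients need none.
module IntegerCoefficients {c ℓ : Level} (R : CommutativeRing c ℓ) where
  open CommutativeRing R
  open import Algebra.Properties.Semiring.Mult semiring using (×-homo-+; ×1-homo-*) renaming (_×_ to _×ᴿ_)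
  open import Algebra.Properties.Ring ring using (x[y-z]≈xy-xz; [y-z]x≈yx-zx)
  open import Algebra.Properties.AbelianGroup +-abelianGroup using (⁻¹-∙-comm; ⁻¹-anti-homo‿-)
  open import Algebra.Properties.Group +-group using (ε⁻¹≈ε)
  open import Algebra.Properties.CommutativeSemigroup +-commutativeSemigroup using (interchange)
  open import Relation.Binary.Reasoning.Setoid setoid

  -- (m , n) stands for the integer m - n.
  ℤ₂ : Set
  ℤ₂ = ℕ × ℕ

  ι : ℕ → Carrier
  ι n = n ×ᴿ 1#

  ⟦_⟧ : ℤ₂ → Carrier
  ⟦ m , n ⟧ = ι m - ι n

  -- The canonical representative: it makes the solver's normal forms of equal polynomials coincide.
  normalise : ℤ₂ → ℤ₂
  normalise (m , n) = m ∸ n , n ∸ m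

  -‿interchange : ∀ x y z w → (x - y) + (z - w) ≈ (x + z) - (y + w)
  -‿interchange x y z w = trans (interchange x (- y) z (- w)) (+-congˡ (⁻¹-∙-comm y w))

  -‿cancelˡ : ∀ w x y → (w + x) - (w + y) ≈ x - y
  -‿cancelˡ w x y = begin
    (w + x) - (w + y)  ≈⟨ -‿interchange w w x y ⟨
    (w - w) + (x - y)  ≈⟨ +-congʳ (-‿inverseʳ w) ⟩
    0# + (x - y)       ≈⟨ +-identityˡ _ ⟩
    x - y              ∎

  ⟦normalise⟧ : ∀ i → ⟦ normalise i ⟧ ≈ ⟦ i ⟧
  ⟦normalise⟧ (zero  , zero)  = refl
  ⟦normalise⟧ (zero  , suc n) = refl
  ⟦normalise⟧ (suc m , zero)  = refl
  ⟦normalise⟧ (suc m , suc n) = trans (⟦normalise⟧ (m , n)) (sym (-‿cancelˡ 1# _ _))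

  coefficients : RawRing 0ℓ 0ℓ
  coefficients = record
    { Carrier = ℤ₂
    ; _≈_     = _≡_
    ; _+_     = λ (m , n) (m′ , n′) → normalise (m ℕ.+ m′ , n ℕ.+ n′)
    ; _*_     = λ (m , n) (m′ , n′) → normalise (m ℕ.* m′ ℕ.+ n ℕ.* n′ , m ℕ.* n′ ℕ.+ n ℕ.* m′)
    ; -_      = λ (m , n) → n , m
    ; 0#      = 0 , 0
    ; 1#      = 1 , 0
    }

  +-homo : ∀ i j → ⟦ RawRing._+_ coefficients i j ⟧ ≈ ⟦ i ⟧ + ⟦ j ⟧
  +-homo (m , n) (m′ , n′) = begin
    ⟦ normalise (m ℕ.+ m′ , n ℕ.+ n′) ⟧  ≈⟨ ⟦normalise⟧ (m ℕ.+ m′ , n ℕ.+ n′) ⟩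
    ι (m ℕ.+ m′) - ι (n ℕ.+ n′)          ≈⟨ +-cong (×-homo-+ 1# m m′) (-‿cong (×-homo-+ 1# n n′)) ⟩
    (ι m + ι m′) - (ι n + ι n′)          ≈⟨ -‿interchange _ _ _ _ ⟨
    ⟦ m , n ⟧ + ⟦ m′ , n′ ⟧              ∎

  *-homo : ∀ i j → ⟦ RawRing._*_ coefficients i j ⟧ ≈ ⟦ i ⟧ * ⟦ j ⟧
  *-homo (m , n) (m′ , n′) = begin
    ⟦ normalise (p , q) ⟧                 ≈⟨ ⟦normalise⟧ (p , q) ⟩
    ι p - ι q                             ≈⟨ +-cong (ι-+-* m m′ n n′) (-‿cong (trans (ι-+-* m n′ n m′) (+-comm _ _))) ⟩
    (a * a′ + b * b′) - (b * a′ + a * b′) ≈⟨ -‿interchange _ _ _ _ ⟨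
    (a * a′ - b * a′) + (b * b′ - a * b′) ≈⟨ +-congˡ (⁻¹-anti-homo‿- _ _) ⟨
    (a * a′ - b * a′) - (a * b′ - b * b′) ≈⟨ +-cong ([y-z]x≈yx-zx a′ a b) (-‿cong ([y-z]x≈yx-zx b′ a b)) ⟨
    (a - b) * a′ - (a - b) * b′           ≈⟨ x[y-z]≈xy-xz (a - b) a′ b′ ⟨
    (a - b) * (a′ - b′)                   ∎
    where
    p q : ℕ
    p = m ℕ.* m′ ℕ.+ n ℕ.* n′
    q = m ℕ.* n′ ℕ.+ n ℕ.* m′
    a b a′ b′ : Carrier
    a = ι m ; b = ι n ; a′ = ι m′ ; b′ = ι n′
    ι-+-* : ∀ k l k′ l′ → ι (k ℕ.* l ℕ.+ k′ ℕ.* l′) ≈ ι k * ι l + ι k′ * ι l′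
    ι-+-* k l k′ l′ = trans (×-homo-+ 1# (k ℕ.* l) (k′ ℕ.* l′)) (+-cong (×1-homo-* k l) (×1-homo-* k′ l′))

  homomorphism : coefficients -Raw-AlmostCommutative⟶ fromCommutativeRing R
  homomorphism = record
    { ⟦_⟧    = ⟦_⟧
    ; +-homo = +-homo
    ; *-homo = *-homo
    ; -‿homo = λ (m , n) → sym (⁻¹-anti-homo‿- (ι m) (ι n))
    ; 0-homo = -‿inverseʳ 0#
    ; 1-homo = trans (+-cong (+-identityʳ 1#) ε⁻¹≈ε) (+-identityʳ 1#)
    }

  ⟦⟧-cong : ∀ m n m′ n′ → m ℕ.+ n′ ≡ m′ ℕ.+ n → ⟦ m , n ⟧ ≈ ⟦ m′ , n′ ⟧
  ⟦⟧-cong m n m′ n′ e = begin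
    ι m - ι n                      ≈⟨ -‿cancelˡ (ι n′) (ι m) (ι n) ⟨
    (ι n′ + ι m) - (ι n′ + ι n)    ≈⟨ +-cong (+-comm _ _) (-‿cong (+-comm _ _)) ⟩
    (ι m + ι n′) - (ι n + ι n′)    ≈⟨ +-congʳ ι[m+n′]≈ι[m′+n] ⟩
    (ι m′ + ι n) - (ι n + ι n′)    ≈⟨ +-congʳ (+-comm _ _) ⟩
    (ι n + ι m′) - (ι n + ι n′)    ≈⟨ -‿cancelˡ (ι n) (ι m′) (ι n′) ⟩
    ι m′ - ι n′                    ∎
    where
    ι[m+n′]≈ι[m′+n] : ι m + ι n′ ≈ ι m′ + ι n
    ι[m+n′]≈ι[m′+n] = trans (sym (×-homo-+ 1# m n′)) (trans (reflexive (≡.cong ι e)) (×-homo-+ 1# m′ n))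

  _≟_ : WeaklyDecidable (Induced-equivalence homomorphism)
  (m , n) ≟ (m′ , n′) with m ℕ.+ n′ ℕ.≟ m′ ℕ.+ n
  ... | yes e = just (⟦⟧-cong m n m′ n′ e)
  ... | no _  = nothing

  open import Algebra.Solver.Ring coefficients (fromCommutativeRing R) homomorphism _≟_ public
    using (solve; _:=_; _:+_; _:*_; _:-_; :-_; Polynomial)

module FieldProperties {c₀ ℓ₀ : Level} (K : Field c₀ ℓ₀) where
  open Field K
  open FieldDefs K
  open import Algebra.Properties.CommutativeSemiring.Exp commutativeSemiring
    using (_^_; ^-congˡ; ^-distrib-*; ^-assocʳ)
  open import Algebra.Properties.CommutativeMonoid.Sum *-commutativeMonoid
    using () renaming (sum to ∏; ∑-distrib-+ to ∏-distrib-*; sum-replicate to ∏-replicate;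
                       ∑-permute to ∏-permute; sum-cong-≋ to ∏-cong)
  open import Algebra.Properties.Group +-group using (ε⁻¹≈ε)
  open import Relation.Binary.Reasoning.Setoid setoid

  x≈0⇒x*y≈0 : ∀ {x} y → x ≈ 0# → x * y ≈ 0#
  x≈0⇒x*y≈0 y x≈0 = trans (*-congʳ x≈0) (zeroˡ y)

  y≈0⇒x-y≈x : ∀ x {y} → y ≈ 0# → x - y ≈ x
  y≈0⇒x-y≈x x y≈0 = trans (+-congˡ (trans (-‿cong y≈0) ε⁻¹≈ε)) (+-identityʳ x)

  x*y≈1⇒y≉0 : ∀ {x y} → x * y ≈ 1# → y ≉ 0#
  x*y≈1⇒y≉0 {x} xy≈1 y≈0 = 0≉1 (trans (sym (trans (*-congˡ y≈0) (zeroʳ x))) xy≈1)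

  *-cancelʳ : ∀ {x y z} → z ≉ 0# → x * z ≈ y * z → x ≈ y
  *-cancelʳ {x} {y} {z} z≉0 xz≈yz = begin
    x              ≈⟨ *-identityʳ x ⟨
    x * 1#         ≈⟨ *-congˡ zz⁻¹≈1 ⟨
    x * (z * z⁻¹)  ≈⟨ *-assoc x z z⁻¹ ⟨
    (x * z) * z⁻¹  ≈⟨ *-congʳ xz≈yz ⟩
    (y * z) * z⁻¹  ≈⟨ *-assoc y z z⁻¹ ⟩
    y * (z * z⁻¹)  ≈⟨ *-congˡ zz⁻¹≈1 ⟩
    y * 1#         ≈⟨ *-identityʳ y ⟩
    y              ∎
    where
    z⁻¹ : Carrier
    z⁻¹ = proj₁ (inverse z z≉0)
    zz⁻¹≈1 : z * z⁻¹ ≈ 1#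
    zz⁻¹≈1 = proj₂ (inverse z z≉0)

  x*y≉0 : ∀ {x y} → x ≉ 0# → y ≉ 0# → x * y ≉ 0#
  x*y≉0 {x} {y} x≉0 y≉0 xy≈0 = x≉0 (*-cancelʳ y≉0 (trans xy≈0 (sym (zeroˡ y))))

  x*x≈0⇒x≈0 : ∀ {x} → Dec (x ≈ 0#) → x * x ≈ 0# → x ≈ 0#
  x*x≈0⇒x≈0 (yes x≈0) _    = x≈0
  x*x≈0⇒x≈0 (no x≉0)  xx≈0 = ⊥-elim (x*y≉0 x≉0 x≉0 xx≈0)

  x^n≉0 : ∀ {x} n → x ≉ 0# → x ^ n ≉ 0#
  x^n≉0 zero    x≉0 1≈0 = 0≉1 (sym 1≈0)
  x^n≉0 (suc n) x≉0     = x*y≉0 x≉0 (x^n≉0 n x≉0)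

  ∏≉0 : ∀ {m} (f : Fin m → Carrier) → (∀ j → f j ≉ 0#) → ∏ f ≉ 0#
  ∏≉0 {zero}  f f≉0 1≈0 = 0≉1 (sym 1≈0)
  ∏≉0 {suc m} f f≉0     = x*y≉0 (f≉0 F.zero) (∏≉0 (λ j → f (F.suc j)) (λ j → f≉0 (F.suc j)))

  ∏-scale : ∀ {m} x (f : Fin m → Carrier) → ∏ (λ j → x * f j) ≈ x ^ m * ∏ f
  ∏-scale {m} x f = trans (∏-distrib-* (λ _ → x) f) (*-congʳ (∏-replicate m))

  ≈-decidable : ∀ {n} → HasCardinality n → Decidable _≈_
  ≈-decidable (enum , enum-injective , enum-surjective) x y
    with enum-surjective x | enum-surjective y
  ... | i , enum-i≈x | j , enum-j≈y with i F.≟ j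
  ...   | yes ≡.refl = yes (trans (sym enum-i≈x) enum-j≈y)
  ...   | no i≢j     = no λ x≈y → i≢j (enum-injective i j (trans enum-i≈x (trans x≈y (sym enum-j≈y))))

  module Units {m} (card : HasCardinality (suc m)) where
    private
      enum : Fin (suc m) → Carrier
      enum = proj₁ card
      enum-injective : ∀ i j → enum i ≈ enum j → i ≡ j
      enum-injective = proj₁ (proj₂ card)
      enum-surjective : ∀ x → ∃ λ i → enum i ≈ x
      enum-surjective = proj₂ (proj₂ card)
      z : Fin (suc m)
      z = proj₁ (enum-surjective 0#)
      enum-z≈0 : enum z ≈ 0#
      enum-z≈0 = proj₂ (enum-surjective 0#)

    unit : Fin m → Carrier
    unit j = enum (F.punchIn z j)

    unit≉0 : ∀ j → unit j ≉ 0#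
    unit≉0 j unit≈0 = punchInᵢ≢i z j (enum-injective _ _ (trans unit≈0 (sym enum-z≈0)))

    unit-injective : ∀ i j → unit i ≈ unit j → i ≡ j
    unit-injective i j ui≈uj = punchIn-injective z i j (enum-injective _ _ ui≈uj)

    unit-surjective : ∀ y → y ≉ 0# → ∃ λ j → unit j ≈ y
    unit-surjective y y≉0 with enum-surjective y
    ... | i , enum-i≈y = F.punchOut z≢i , trans (reflexive (≡.cong enum (punchIn-punchOut z≢i))) enum-i≈y
      where
      z≢i : z ≢ i
      z≢i ≡.refl = y≉0 (trans (sym enum-i≈y) enum-z≈0)

    module Scaling {x} (x≉0 : x ≉ 0#) where
      scale : Fin m → Fin m
      scale j = proj₁ (unit-surjective (x * unit j) (x*y≉0 x≉0 (unit≉0 j)))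

      unit-scale : ∀ j → unit (scale j) ≈ x * unit j
      unit-scale j = proj₂ (unit-surjective (x * unit j) (x*y≉0 x≉0 (unit≉0 j)))

    open Scaling

    scale-inverse : ∀ {x y} (x≉0 : x ≉ 0#) (y≉0 : y ≉ 0#) → x * y ≈ 1# →
                    ∀ j → scale x≉0 (scale y≉0 j) ≡ j
    scale-inverse {x} {y} x≉0 y≉0 xy≈1 j = unit-injective _ _ (begin
      unit (scale x≉0 (scale y≉0 j))  ≈⟨ unit-scale x≉0 _ ⟩
      x * unit (scale y≉0 j)          ≈⟨ *-congˡ (unit-scale y≉0 j) ⟩
      x * (y * unit j)                ≈⟨ *-assoc x y (unit j) ⟨
      (x * y) * unit j                ≈⟨ *-congʳ xy≈1 ⟩
      1# * unit j                     ≈⟨ *-identityˡ (unit j) ⟩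
      unit j                          ∎)

    -- Multiplication by x permutes the units, so it fixes their product.
    x^m≈1 : ∀ {x} → x ≉ 0# → x ^ m ≈ 1#
    x^m≈1 {x} x≉0 = *-cancelʳ (∏≉0 unit unit≉0) (begin
      x ^ m * ∏ unit                   ≈⟨ ∏-scale x unit ⟨
      ∏ (λ j → x * unit j)             ≈⟨ ∏-cong (λ j → sym (unit-scale x≉0 j)) ⟩
      ∏ (λ j → unit (scale x≉0 j))     ≈⟨ ∏-permute unit scaling ⟨
      ∏ unit                           ≈⟨ *-identityˡ _ ⟨
      1# * ∏ unit                      ∎)
      where
      x⁻¹ : Carrier
      x⁻¹ = proj₁ (inverse x x≉0)
      xx⁻¹≈1 : x * x⁻¹ ≈ 1#
      xx⁻¹≈1 = proj₂ (inverse x x≉0)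
      x⁻¹≉0 : x⁻¹ ≉ 0#
      x⁻¹≉0 = x*y≈1⇒y≉0 xx⁻¹≈1
      scaling : Permutation′ m
      scaling = permutation (scale x≉0) (scale x⁻¹≉0)
        (scale-inverse x≉0 x⁻¹≉0 xx⁻¹≈1) (scale-inverse x⁻¹≉0 x≉0 (trans (*-comm x⁻¹ x) xx⁻¹≈1))

  x^n≈x : ∀ {n} → HasCardinality n → ∀ x → x ^ n ≈ x
  x^n≈x {zero} (_ , _ , enum-surjective) x with () ← proj₁ (enum-surjective x)
  x^n≈x {suc m} card x with ≈-decidable card x 0#
  ... | yes x≈0 = trans (*-congʳ x≈0) (trans (zeroˡ _) (sym x≈0))
  ... | no x≉0  = trans (*-congˡ (Units.x^m≈1 card x≉0)) (*-identityʳ x)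

  pow≡^ : ∀ x n → pow x n ≡ x ^ n
  pow≡^ x zero    = ≡.refl
  pow≡^ x (suc n) = ≡.cong (x *_) (pow≡^ x n)

  pow-congˡ : ∀ {x y} n → x ≈ y → pow x n ≈ pow y n
  pow-congˡ {x} {y} n x≈y rewrite pow≡^ x n | pow≡^ y n = ^-congˡ n x≈y

  pow-distrib-* : ∀ x y n → pow (x * y) n ≈ pow x n * pow y n
  pow-distrib-* x y n rewrite pow≡^ (x * y) n | pow≡^ x n | pow≡^ y n = ^-distrib-* x y n

  pow-assocʳ : ∀ x m n → pow (pow x m) n ≈ pow x (m ℕ.* n)
  pow-assocʳ x m n rewrite pow≡^ (pow x m) n | pow≡^ x m | pow≡^ x (m ℕ.* n) = ^-assocʳ x m n

  pow-1# : ∀ n → pow 1# n ≈ 1#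
  pow-1# zero    = refl
  pow-1# (suc n) = trans (*-identityˡ _) (pow-1# n)

  pow≉0 : ∀ {x} n → x ≉ 0# → pow x n ≉ 0#
  pow≉0 {x} n rewrite pow≡^ x n = x^n≉0 n

  pow-cardinality : ∀ {n} → HasCardinality n → ∀ x → pow x n ≈ x
  pow-cardinality {n} card x rewrite pow≡^ x n = x^n≈x card x

module Matrices {c₀ ℓ₀ : Level} (K : Field c₀ ℓ₀) where
  open Field K
  open FieldDefs K
  open FieldProperties K
  open IntegerCoefficients commutativeRing using (solve; _:=_; _:+_; _:*_; _:-_; :-_; Polynomial)
  open import Algebra.Properties.Group +-group using (ε⁻¹≈ε; ⁻¹-injective)
  open import Relation.Binary.Reasoning.Setoid setoid

  private
    record PolyMat (n : ℕ) : Set where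
      constructor pmat
      field pa pb pc pd : Polynomial n
    open PolyMat

    _⊙_ : ∀ {n} → PolyMat n → PolyMat n → PolyMat n
    m ⊙ n = pmat (pa m :* pa n :+ pb m :* pc n) (pa m :* pb n :+ pb m :* pd n)
                 (pc m :* pa n :+ pd m :* pc n) (pc m :* pb n :+ pd m :* pd n)

    padj : ∀ {n} → PolyMat n → PolyMat n
    padj m = pmat (pd m) (:- pb m) (:- pc m) (pa m)

    pdet : ∀ {n} → PolyMat n → Polynomial n
    pdet m = pa m :* pd m :- pb m :* pc m

  det-· : ∀ m n → det (m · n) ≈ det m * det n
  det-· (mat x₁ x₂ x₃ x₄) (mat y₁ y₂ y₃ y₄) =
    solve 8 (λ x₁ x₂ x₃ x₄ y₁ y₂ y₃ y₄ →
      pdet (pmat x₁ x₂ x₃ x₄ ⊙ pmat y₁ y₂ y₃ y₄) := pdet (pmat x₁ x₂ x₃ x₄) :* pdet (pmat y₁ y₂ y₃ y₄))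
      refl x₁ x₂ x₃ x₄ y₁ y₂ y₃ y₄

  det-adj : ∀ m → det (adj m) ≈ det m
  det-adj (mat x₁ x₂ x₃ x₄) =
    solve 4 (λ x₁ x₂ x₃ x₄ → pdet (padj (pmat x₁ x₂ x₃ x₄)) := pdet (pmat x₁ x₂ x₃ x₄)) refl x₁ x₂ x₃ x₄

  adj-sandwich : ∀ m g n → IsSL m → IsSL n → ((adj m · ((m · g) · adj n)) · n) ≈M g
  adj-sandwich (mat m₁ m₂ m₃ m₄) (mat g₁ g₂ g₃ g₄) (mat n₁ n₂ n₃ n₄) detm≈1 detn≈1 =
    trans (solve 12 (sandwich-scales pa) refl m₁ m₂ m₃ m₄ g₁ g₂ g₃ g₄ n₁ n₂ n₃ n₄) (unit-scalar g₁) ,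
    trans (solve 12 (sandwich-scales pb) refl m₁ m₂ m₃ m₄ g₁ g₂ g₃ g₄ n₁ n₂ n₃ n₄) (unit-scalar g₂) ,
    trans (solve 12 (sandwich-scales pc) refl m₁ m₂ m₃ m₄ g₁ g₂ g₃ g₄ n₁ n₂ n₃ n₄) (unit-scalar g₃) ,
    trans (solve 12 (sandwich-scales pd) refl m₁ m₂ m₃ m₄ g₁ g₂ g₃ g₄ n₁ n₂ n₃ n₄) (unit-scalar g₄)
    where
    sandwich-scales : (PolyMat 12 → Polynomial 12) → N-ary 12 (Polynomial 12) (Polynomial 12 × Polynomial 12)
    sandwich-scales entry m₁ m₂ m₃ m₄ g₁ g₂ g₃ g₄ n₁ n₂ n₃ n₄ =
      entry ((padj M ⊙ ((M ⊙ G) ⊙ padj N)) ⊙ N) := (pdet M :* pdet N) :* entry G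
      where
      M = pmat m₁ m₂ m₃ m₄
      G = pmat g₁ g₂ g₃ g₄
      N = pmat n₁ n₂ n₃ n₄

    unit-scalar : ∀ x → (det (mat m₁ m₂ m₃ m₄) * det (mat n₁ n₂ n₃ n₄)) * x ≈ x
    unit-scalar x = trans (*-congʳ (trans (*-cong detm≈1 detn≈1) (*-identityˡ 1#))) (*-identityˡ x)

  c-conjugate-unipotent : ∀ h u z → c ((h · mat u u z u) · adj h) ≈ (d h * d h) * z - (c h * c h) * u
  c-conjugate-unipotent (mat h₁ h₂ h₃ h₄) =
    solve 6 (λ h₁ h₂ h₃ h₄ u z →
      pc ((pmat h₁ h₂ h₃ h₄ ⊙ pmat u u z u) ⊙ padj (pmat h₁ h₂ h₃ h₄)) := (h₄ :* h₄) :* z :- (h₃ :* h₃) :* u)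
      refl h₁ h₂ h₃ h₄

  normaliser⇒c²≈0 : ∀ h → InNormalizerT h → c h * c h ≈ 0#
  normaliser⇒c²≈0 h (_ , conjugate-T , _) = ⁻¹-injective (begin
    - (c h * c h)                                  ≈⟨ +-identityˡ _ ⟨
    0# - (c h * c h)                               ≈⟨ +-cong (zeroʳ _) (-‿cong (*-identityʳ _)) ⟨
    (d h * d h) * 0# - (c h * c h) * 1#            ≈⟨ c-conjugate-unipotent h 1# 0# ⟨
    c ((h · mat 1# 1# 0# 1#) · adj h)              ≈⟨ proj₁ (proj₂ (conjugate-T _ (refl , refl , refl))) ⟩
    0#                                             ≈⟨ ε⁻¹≈ε ⟨
    - 0#                                           ∎)

  c-adj-·-· : ∀ h g n → c h ≈ 0# → c n ≈ 0# → c ((adj h · g) · n) ≈ (a h * a n) * c g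
  c-adj-·-· (mat h₁ h₂ h₃ h₄) (mat g₁ g₂ g₃ g₄) (mat n₁ n₂ n₃ n₄) h₃≈0 n₃≈0 = begin
    c ((adj (mat h₁ h₂ h₃ h₄) · mat g₁ g₂ g₃ g₄) · mat n₁ n₂ n₃ n₄)
      ≈⟨ solve 12 (λ h₁ h₂ h₃ h₄ g₁ g₂ g₃ g₄ n₁ n₂ n₃ n₄ →
           pc ((padj (pmat h₁ h₂ h₃ h₄) ⊙ pmat g₁ g₂ g₃ g₄) ⊙ pmat n₁ n₂ n₃ n₄)
             := (h₁ :* n₁) :* g₃ :+ (n₃ :* (h₁ :* g₄) :- h₃ :* (g₁ :* n₁ :+ g₂ :* n₃)))
           refl h₁ h₂ h₃ h₄ g₁ g₂ g₃ g₄ n₁ n₂ n₃ n₄ ⟩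
    (h₁ * n₁) * g₃ + (n₃ * (h₁ * g₄) - h₃ * (g₁ * n₁ + g₂ * n₃))
      ≈⟨ +-congˡ (trans (+-cong (x≈0⇒x*y≈0 _ n₃≈0) (-‿cong (x≈0⇒x*y≈0 _ h₃≈0))) (-‿inverseʳ 0#)) ⟩
    (h₁ * n₁) * g₃ + 0#
      ≈⟨ +-identityʳ _ ⟩
    (h₁ * n₁) * g₃ ∎

  det-upper : ∀ h → c h ≈ 0# → det h ≈ a h * d h
  det-upper h c≈0 = y≈0⇒x-y≈x _ (trans (*-congˡ c≈0) (zeroʳ (b h)))

  det-frobM-upper : ∀ q h → c h ≈ 0# → det (frobM (suc q) h) ≈ pow (det h) (suc q)
  det-frobM-upper q h c≈0 = begin
    det (frobM n h)              ≈⟨ det-upper (frobM n h) (x≈0⇒x*y≈0 _ c≈0) ⟩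
    pow (a h) n * pow (d h) n    ≈⟨ pow-distrib-* (a h) (d h) n ⟨
    pow (a h * d h) n            ≈⟨ pow-congˡ n (det-upper h c≈0) ⟨
    pow (det h) n                ∎
    where
    n : ℕ
    n = suc q

  ·-preserves-SL : ∀ {m n} → IsSL m → IsSL n → IsSL (m · n)
  ·-preserves-SL {m} {n} m∈SL n∈SL = trans (det-· m n) (trans (*-cong m∈SL n∈SL) (*-identityˡ 1#))

  adj-preserves-SL : ∀ {m} → IsSL m → IsSL (adj m)
  adj-preserves-SL {m} = trans (det-adj m)

  ϑ-preserves-SL : ∀ q {h g} → IsSL h → IsSL (frobM q h) → IsSL g → IsSL (ϑ q h g)
  ϑ-preserves-SL q h∈SL h̄∈SL g∈SL = ·-preserves-SL (·-preserves-SL (adj-preserves-SL h∈SL) g∈SL) h̄∈SL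

  ϑ-surjective : ∀ q {h} → IsSL h → IsSL (frobM q h) →
                 ∀ g′ → IsSL g′ → ∃ λ g → IsSL g × ϑ q h g ≈M g′
  ϑ-surjective q {h} h∈SL h̄∈SL g′ g′∈SL =
      (h · g′) · adj (frobM q h)
    , ·-preserves-SL (·-preserves-SL h∈SL g′∈SL) (adj-preserves-SL h̄∈SL)
    , adj-sandwich h g′ (frobM q h) h∈SL h̄∈SL

module Subfield {c₀ ℓ₀ : Level} (K : Field c₀ ℓ₀) (q : ℕ) where
  open Field K
  open FieldDefs K
  open FieldProperties K
  open import Relation.Binary.Reasoning.Setoid setoid

  InFq-resp : ∀ {x y} → x ≈ y → InFq q x → InFq q y
  InFq-resp x≈y x∈Fq = trans (pow-congˡ q (sym x≈y)) (trans x∈Fq x≈y)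

  InFq-* : ∀ {x y} → InFq q x → InFq q y → InFq q (x * y)
  InFq-* {x} {y} x∈Fq y∈Fq = trans (pow-distrib-* x y q) (*-cong x∈Fq y∈Fq)

  InFq-*-cancelˡ : ∀ {x y} → x ≉ 0# → InFq q x → InFq q (x * y) → InFq q y
  InFq-*-cancelˡ {x} {y} x≉0 x∈Fq xy∈Fq = *-cancelʳ x≉0 (begin
    pow y q * x        ≈⟨ *-comm _ _ ⟩
    x * pow y q        ≈⟨ *-congʳ x∈Fq ⟨
    pow x q * pow y q  ≈⟨ pow-distrib-* x y q ⟨
    pow (x * y) q      ≈⟨ xy∈Fq ⟩
    x * y              ≈⟨ *-comm _ _ ⟩
    y * x              ∎)

  norm∈Fq : HasCardinality (q ℕ.^ 2) → ∀ x → InFq q (x * pow x q)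
  norm∈Fq card x = begin
    pow (x * pow x q) q          ≈⟨ pow-distrib-* x (pow x q) q ⟩
    pow x q * pow (pow x q) q    ≈⟨ *-congˡ (pow-assocʳ x q q) ⟩
    pow x q * pow x (q ℕ.* q)    ≡⟨ ≡.cong (λ n → pow x q * pow x (q ℕ.* n)) (ℕₚ.*-identityʳ q) ⟨
    pow x q * pow x (q ℕ.^ 2)    ≈⟨ *-congˡ (pow-cardinality card x) ⟩
    pow x q * x                  ≈⟨ *-comm _ _ ⟩
    x * pow x q                  ∎

  c-scaling⇒mapsOnto-Ω×Ωᶜ :
    ∀ (f : Mat → Mat) {u} → u ≉ 0# → InFq q u → (∀ g → c (f g) ≈ u * c g) →
    (∀ g → IsSL g → IsSL (f g)) → (∀ g′ → IsSL g′ → ∃ λ g → IsSL g × f g ≈M g′) →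
    MapsOnto f (Ω q) × MapsOnto f (Ωᶜ q)
  c-scaling⇒mapsOnto-Ω×Ωᶜ f {u} u≉0 u∈Fq c-f f-SL f-onto =
      ( (λ g (g∈SL , c∈Fq) → f-SL g g∈SL , to g c∈Fq)
      , λ g′ (g′∈SL , c′∈Fq) → let (g , g∈SL , fg≈g′) = f-onto g′ g′∈SL in
          g , (g∈SL , from g (InFq-resp (sym (c-cong fg≈g′)) c′∈Fq)) , fg≈g′ )
    , ( (λ g (g∈SL , c∉Fq) → f-SL g g∈SL , λ fc∈Fq → c∉Fq (from g fc∈Fq))
      , λ g′ (g′∈SL , c′∉Fq) → let (g , g∈SL , fg≈g′) = f-onto g′ g′∈SL in
          g , (g∈SL , λ c∈Fq → c′∉Fq (InFq-resp (c-cong fg≈g′) (to g c∈Fq))) , fg≈g′ )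
    where
    to : ∀ g → InFq q (c g) → InFq q (c (f g))
    to g c∈Fq = InFq-resp (sym (c-f g)) (InFq-* u∈Fq c∈Fq)

    from : ∀ g → InFq q (c (f g)) → InFq q (c g)
    from g fc∈Fq = InFq-*-cancelˡ u≉0 u∈Fq (InFq-resp (c-f g) fc∈Fq)

    c-cong : ∀ {m n} → m ≈M n → c m ≈ c n
    c-cong (_ , _ , c≈ , _) = c≈

mainTheorem3 : ∀ {c ℓ : Level} (K : Field c ℓ) (q : ℕ) → IsPrimePower q
    → FieldDefs.HasCardinality K (q ℕ.^ 2)
    → ∀ h → FieldDefs.InNormalizerT K h
    → FieldDefs.MapsOnto K (FieldDefs.ϑ K q h) (FieldDefs.Ω K q)
      × FieldDefs.MapsOnto K (FieldDefs.ϑ K q h) (FieldDefs.Ωᶜ K q)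
mainTheorem3 K zero _ (_ , _ , enum-surjective) _ _ with () ← proj₁ (enum-surjective (Field.0# K))
mainTheorem3 K q@(suc q′) _ card h h∈N@(h∈SL , _) =
  c-scaling⇒mapsOnto-Ω×Ωᶜ (ϑ q h) N≉0 (norm∈Fq card (a h)) c-ϑ
    (λ g → ϑ-preserves-SL q h∈SL h̄∈SL) (ϑ-surjective q h∈SL h̄∈SL)
  where
  open Field K
  open FieldDefs K
  open FieldProperties K
  open Matrices K
  open Subfield K q

  c≈0 : c h ≈ 0#
  c≈0 = x*x≈0⇒x≈0 (≈-decidable card (c h) 0#) (normaliser⇒c²≈0 h h∈N)

  h̄∈SL : IsSL (frobM q h)
  h̄∈SL = trans (det-frobM-upper q′ h c≈0) (trans (pow-congˡ q h∈SL) (pow-1# q))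

  N : Carrier
  N = a h * pow (a h) q

  N≉0 : N ≉ 0#
  N≉0 = x*y≉0 a≉0 (pow≉0 q a≉0)
    where
    a≉0 : a h ≉ 0#
    a≉0 = x*y≈1⇒y≉0 (trans (*-comm (d h) (a h)) (trans (sym (det-upper h c≈0)) h∈SL))

  c-ϑ : ∀ g → c (ϑ q h g) ≈ N * c g
  c-ϑ g = c-adj-·-· h g (frobM q h) c≈0 (x≈0⇒x*y≈0 _ c≈0)
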